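{- Let $\Phi$ be a (valid) non-adaptive $(m,n,s,3)$-scheme with MAJORITY as the query function. Then no model-graph for $\Phi$ is forced.
   Context: Such a scheme $\Phi$: memory is a bit array $A[1..s]$; each $u\in[m]$ has three distinct probe locations $x(u),y(u),z(u)\in[s]$; for every $S\subseteq[m]$ with $|S|\le n$ there is an assignment $\sigma(S)\in\{0,1\}^s$ to $A$ such that for all $u\in[m]$, $\mathrm{Maj}(A[x(u)],A[y(u)],A[z(u)])=1$ iff $u\in S$ ($\mathrm{Maj}$ = majority of 3 bits). A model-graph for $\Phi$ is a (multi)graph $G$ with vertex set $[s]$ and exactly $m$ edges, bijectively labelled by $[m]$, such that the edge labelled $u$ has its endpoint set in $\{\{x(u),y(u)\},\{y(u),z(u)\},\{z(u),x(u)\}\}$. If $e$ is the endpoint set of the edge labelled $u$, the unique element of $\{x(u),y(u),z(u)\}\setminus e$ is the third vertex of $u$. Two edge-disjoint cycles $C_1,C_2$ meet if there are $u,v\in[m]$ with the same third vertex such that the edge labelled $u$ is in $C_1$ and the edge labelled $v$ is in $C_2$. A model-graph is forced if at least one holds: (P1) there are edge-disjoint odd cycles $C_1,C_2$, each of length at most $n$, sharing a vertex; (P2) there are edge-disjoint even cycles $C_1,C_2$, each of length at most $n$, that meet; (P3) there is an even cycle $C$ of length at most $n$ containing two edges, labelled $e$ and $f$, such that an even number of edges lies between them when traversing $C$ in order, and the third vertices of $e$ and $f$ coincide. -}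

module Defs where

open import Data.Nat using (ℕ; zero; suc; _≤_; _<_; _∸_)
open import Data.Nat.Divisibility using (_∣_)
open import Data.Bool using (Bool; true; false; _∧_; _∨_)
open import Data.Fin using (Fin; zero; suc; toℕ; inject₁; fromℕ)
open import Data.Fin.Subset using (Subset; _∈_; ∣_∣)
open import Data.Product using (Σ; _×_; _,_; ∃-syntax)
open import Data.Sum using (_⊎_)
open import Relation.Nullary using (¬_)
open import Relation.Binary.PropositionalEquality using (_≡_; _≢_)
open import Function.Bundles using (_⇔_)
open import Function.Definitions using (Injective)

maj : Bool → Bool → Bool → Bool
maj a b c = (a ∧ b) ∨ ((b ∧ c) ∨ (c ∧ a))

record Scheme (m n s : ℕ) : Set where
  field
    x y z : Fin m → Fin s
    x≢y : ∀ u → x u ≢ y u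
    y≢z : ∀ u → y u ≢ z u
    z≢x : ∀ u → z u ≢ x u
    valid : (S : Subset m) → ∣ S ∣ ≤ n →
            Σ (Fin s → Bool) λ σ →
              ∀ u → (maj (σ (x u)) (σ (y u)) (σ (z u)) ≡ true) ⇔ (u ∈ S)

-- A model-graph: for each label u, choose which of the three probes is the
-- third vertex (zero ↦ x, 1 ↦ y, 2 ↦ z); the edge labelled u joins the other two.
-- The edge set is thus exactly [m], bijectively labelled.
ModelGraph : ∀ {m n s} → Scheme m n s → Set
ModelGraph {m} _ = Fin m → Fin 3

module _ {m n s : ℕ} (Φ : Scheme m n s) (G : ModelGraph Φ) where
  open Scheme Φ

  third : Fin m → Fin s
  third u with G u
  ... | zero = z u
  ... | suc zero = x u
  ... | suc (suc zero) = y u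

  end₁ end₂ : Fin m → Fin s
  end₁ u with G u
  ... | zero = x u
  ... | suc zero = y u
  ... | suc (suc zero) = z u
  end₂ u with G u
  ... | zero = y u
  ... | suc zero = z u
  ... | suc (suc zero) = x u

  Joins : Fin m → Fin s → Fin s → Set
  Joins u a b = (end₁ u ≡ a × end₂ u ≡ b) ⊎ (end₁ u ≡ b × end₂ u ≡ a)

  record Cycle (k : ℕ) : Set where
    field
      len≥2 : 2 ≤ k
      edge : Fin k → Fin m
      vert : Fin (suc k) → Fin s
      closed : vert (fromℕ k) ≡ vert zero
      edge-inj : Injective _≡_ _≡_ edge
      vert-inj : Injective _≡_ _≡_ (λ i → vert (inject₁ i))
      joins : ∀ i → Joins (edge i) (vert (inject₁ i)) (vert (suc i))

  Even Odd : ℕ → Set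
  Even k = 2 ∣ k
  Odd k = ¬ (2 ∣ k)

  EdgeDisjoint : ∀ {k l} → Cycle k → Cycle l → Set
  EdgeDisjoint C D = ∀ i j → Cycle.edge C i ≢ Cycle.edge D j

  ShareVertex : ∀ {k l} → Cycle k → Cycle l → Set
  ShareVertex C D = ∃[ i ] ∃[ j ] (Cycle.vert C (inject₁ i) ≡ Cycle.vert D (inject₁ j))

  Meet : ∀ {k l} → Cycle k → Cycle l → Set
  Meet C D = ∃[ i ] ∃[ j ] (third (Cycle.edge C i) ≡ third (Cycle.edge D j))

  P1 P2 P3 : Set
  P1 = ∃[ k ] ∃[ l ] Σ (Cycle k) λ C → Σ (Cycle l) λ D →
         Odd k × Odd l × k ≤ n × l ≤ n × EdgeDisjoint C D × ShareVertex C D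
  P2 = ∃[ k ] ∃[ l ] Σ (Cycle k) λ C → Σ (Cycle l) λ D →
         Even k × Even l × k ≤ n × l ≤ n × EdgeDisjoint C D × Meet C D
  -- positions i < j on C; the number of edges strictly between them is
  -- j - i - 1 (the other way round it is k - (j - i) - 1, same parity as k is even)
  P3 = ∃[ k ] Σ (Cycle k) λ C → Even k × k ≤ n ×
         ∃[ i ] ∃[ j ] (toℕ i < toℕ j × Even (toℕ j ∸ toℕ i ∸ 1) ×
           third (Cycle.edge C i) ≡ third (Cycle.edge C j))

  Forced : Set
  Forced = P1 ⊎ P2 ⊎ P3

-- Put into the query set every second edge of a short cycle, starting at a chosen position.
-- Majority then pins the memory down along the cycle. On an odd cycle the two consecutive
-- selected edges meet at the starting vertex, and the alternation of the answers forces that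
-- vertex to hold 1 (or 0, if the complementary edges are selected). On an even cycle an edge
-- whose endpoints hold equal bits would propagate the alternation once around the cycle to a
-- contradiction, so the third vertex of every edge holds that edge's answer. In each of
-- (P1)-(P3) two such forced values of one memory cell disagree, while the query sets used have
-- at most n elements.

module Submission where

open import Defs
open import Data.Bool using (Bool; true; false; not; T)
open import Data.Bool.Properties using (not-involutive; not-¬; ¬-not; T-≡; ⇔→≡)
  renaming (_≟_ to _≟ᵇ_)
open import Data.Empty using (⊥-elim)
open import Data.Fin using (Fin; zero; suc; toℕ; inject₁; fromℕ)
open import Data.Fin.Properties
  using (toℕ-injective; toℕ-fromℕ<; toℕ-inject₁; toℕ-fromℕ; toℕ<n; toℕ≤pred[n])
open import Data.Fin.Subset using (Subset; outside; inside; ⁅_⁆; _∪_; ∣_∣)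
  renaming (_∈_ to _∈ₛ_; ⊥ to ∅)
open import Data.Fin.Subset.Properties
  using (x∈⁅x⁆; x∈⁅y⁆⇒x≡y; x∈p∪q⁺; x∈p∪q⁻; ∣⁅x⁆∣≡1; ∣⊥∣≡0; ∉⊥)
open import Data.List using (List; []; _∷_; map; filterᵇ; downFrom; length; _++_)
open import Data.List.Properties using (filter-accept; filter-reject; length-++; length-map)
open import Data.List.Membership.Propositional using (_∈_; _∉_)
open import Data.List.Membership.Propositional.Properties
  using (∈-map⁺; ∈-map⁻; ∈-filter⁺; ∈-filter⁻; ∈-downFrom⁺; ∈-downFrom⁻; ∈-++⁺ˡ; ∈-++⁺ʳ; ∈-++⁻)
open import Data.List.Relation.Unary.Any using (here; there)
open import Data.Nat
  using (ℕ; zero; suc; _+_; _*_; _∸_; _≤_; _<_; z≤n; s≤s; NonZero; >-nonZero)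
open import Data.Nat.Properties
open import Data.Nat.DivMod using (_%_; _/_; _mod_; m≡m%n+[m/n]*n; %-distribˡ-+; m%n%n≡m%n;
  [m+n]%n≡m%n; m<n⇒m%n≡m; m%n<n; m%n≤n; n%n≡0)
open import Data.Nat.Divisibility using (_∣_; divides)
open import Data.Product using (∃-syntax; _×_; _,_)
open import Data.Sum using (_⊎_; inj₁; inj₂; [_,_]′)
open import Data.Vec using (_∷_; [])
open import Function using (_∘_; id)
open import Function.Bundles using (_⇔_; mk⇔; Equivalence)
open import Function.Properties.Equivalence using () renaming (trans to ⇔-trans)
open import Relation.Binary.PropositionalEquality
open import Relation.Nullary using (¬_; yes; no)
open import Relation.Nullary.Decidable using (T?)

maj-swap : ∀ a b c → maj a b c ≡ maj b a c
maj-swap true  true  c     = refl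
maj-swap true  false true  = refl
maj-swap true  false false = refl
maj-swap false true  true  = refl
maj-swap false true  false = refl
maj-swap false false true  = refl
maj-swap false false false = refl

maj-rotate : ∀ a b c → maj a b c ≡ maj b c a
maj-rotate true  true  true  = refl
maj-rotate true  true  false = refl
maj-rotate true  false true  = refl
maj-rotate true  false false = refl
maj-rotate false true  true  = refl
maj-rotate false true  false = refl
maj-rotate false false true  = refl
maj-rotate false false false = refl

maj-same : ∀ a c → maj a a c ≡ a
maj-same true  c     = refl
maj-same false true  = refl
maj-same false false = refl

maj-diff : ∀ {a b} c → a ≢ b → maj a b c ≡ c
maj-diff {true}  {true}  c     a≢b = ⊥-elim (a≢b refl)
maj-diff {true}  {false} true  _   = refl
maj-diff {true}  {false} false _   = refl
maj-diff {false} {true}  true  _   = refl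
maj-diff {false} {true}  false _   = refl
maj-diff {false} {false} c     a≢b = ⊥-elim (a≢b refl)

maj-step : ∀ {a b c d} → maj a b c ≡ d → a ≡ not d → b ≡ d
maj-step {true}  {true}  {c}     {false} () refl
maj-step {true}  {false} {c}     {false} _  refl = refl
maj-step {false} {true}  {c}     {true}  _  refl = refl
maj-step {false} {false} {true}  {true}  () refl
maj-step {false} {false} {false} {true}  () refl

alternate : Bool → ℕ → Bool
alternate c zero    = c
alternate c (suc t) = not (alternate c t)

alternate-+ : ∀ c u s → alternate c (u + s) ≡ alternate (alternate c s) u
alternate-+ c zero    s = refl
alternate-+ c (suc u) s = cong not (alternate-+ c u s)

alternate-*2 : ∀ c a → alternate c (a * 2) ≡ c
alternate-*2 c zero    = refl
alternate-*2 c (suc a) = trans (not-involutive _) (alternate-*2 c a)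

alternate-+*2 : ∀ c a t → alternate c (t + a * 2) ≡ alternate c t
alternate-+*2 c a t = trans (alternate-+ c t (a * 2)) (cong (λ d → alternate d t) (alternate-*2 c a))

alternating-run : ∀ (p q : ℕ → Bool) c r → (∀ t → t < r → maj (p t) (p (suc t)) (q t) ≡ alternate c t) →
                  p 0 ≡ not c → p r ≡ not (alternate c r)
alternating-run p q c zero    _ p₀ = p₀
alternating-run p q c (suc r) H p₀ =
  trans (maj-step (H r ≤-refl) (alternating-run p q c r (λ t t<r → H t (m<n⇒m<1+n t<r)) p₀))
        (sym (not-involutive _))

module _ (p q : ℕ → Bool) (c : Bool) where

  odd-closed-walk : ∀ {k a} → k ≡ suc (a * 2) → p k ≡ p 0 →
                    (∀ t → t < k → maj (p t) (p (suc t)) (q t) ≡ alternate c t) → p 0 ≡ c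
  odd-closed-walk {a = a} refl closed H with p 0 ≟ᵇ c
  ... | yes p₀≡c = p₀≡c
  ... | no  p₀≢c = begin
    p 0                                ≡⟨ closed ⟨
    p (suc (a * 2))                    ≡⟨ alternating-run p q c (suc (a * 2)) H (¬-not p₀≢c) ⟩
    not (not (alternate c (a * 2)))    ≡⟨ not-involutive _ ⟩
    alternate c (a * 2)                ≡⟨ alternate-*2 c a ⟩
    c                                  ∎
    where open ≡-Reasoning

  even-closed-walk : ∀ {k a} → k ≡ suc a * 2 → (∀ t → p (t + k) ≡ p t) →
                     (∀ t → maj (p t) (p (suc t)) (q t) ≡ alternate c t) →
                     ∀ t → q t ≡ alternate c t
  even-closed-walk {a = a} refl periodic H t with p t ≟ᵇ p (suc t)
  ... | no  p≢p′ = trans (sym (maj-diff (q t) p≢p′)) (H t)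
  ... | yes p≡p′ = ⊥-elim (not-¬ p≡alt p≡not-alt)
    where
    open ≡-Reasoning
    k′ = suc (a * 2)
    c′ = alternate c (suc t)
    p≡alt : p t ≡ alternate c t
    p≡alt = trans (sym (maj-same (p t) (q t))) (trans (cong (λ b → maj (p t) b (q t)) p≡p′) (H t))
    -- rerun the alternation once around the cycle, starting just after edge t
    run : p (k′ + suc t) ≡ not (alternate c′ k′)
    run = alternating-run (λ u → p (u + suc t)) (λ u → q (u + suc t)) c′ k′
            (λ u _ → trans (H (u + suc t)) (alternate-+ c u (suc t)))
            (trans (sym p≡p′) (trans p≡alt (sym (not-involutive _))))
    around : k′ + suc t ≡ t + suc a * 2
    around = trans (+-suc k′ t) (+-comm (suc k′) t)
    p≡not-alt : p t ≡ not (alternate c t)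
    p≡not-alt = begin
      p t                              ≡⟨ periodic t ⟨
      p (t + suc a * 2)                ≡⟨ cong p around ⟨
      p (k′ + suc t)                   ≡⟨ run ⟩
      not (alternate c′ k′)            ≡⟨ cong not (alternate-+ c k′ (suc t)) ⟨
      not (alternate c (k′ + suc t))   ≡⟨ cong (not ∘ alternate c) around ⟩
      not (alternate c (t + suc a * 2)) ≡⟨ cong not (alternate-+*2 c (suc a) t) ⟩
      not (alternate c t)              ∎

odd⇒≡suc[*2] : ∀ {k} → ¬ 2 ∣ k → ∃[ a ] k ≡ suc (a * 2)
odd⇒≡suc[*2] {k} k-odd = [ (λ (a , k≡a*2) → ⊥-elim (k-odd (divides a k≡a*2))) , id ]′ (parity k)
  where
  parity : ∀ k → (∃[ a ] k ≡ a * 2) ⊎ (∃[ a ] k ≡ suc (a * 2))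
  parity zero    = inj₁ (0 , refl)
  parity (suc k) with parity k
  ... | inj₁ (a , refl) = inj₂ (a , refl)
  ... | inj₂ (a , refl) = inj₁ (suc a , refl)

even⇒≡suc*2 : ∀ {k} → 2 ≤ k → 2 ∣ k → ∃[ a ] k ≡ suc a * 2
even⇒≡suc*2 ()  (divides zero    refl)
even⇒≡suc*2 _   (divides (suc a) refl) = a , refl

halve-≤ : ∀ a b {n} → a * 2 + b * 2 ≤ n + n → a + b ≤ n
halve-≤ a b {n} le = *-cancelʳ-≤ (a + b) n 2 (begin
  (a + b) * 2    ≡⟨ *-distribʳ-+ 2 a b ⟩
  a * 2 + b * 2  ≤⟨ le ⟩
  n + n          ≡⟨ cong (n +_) (+-identityʳ n) ⟨
  2 * n          ≡⟨ *-comm 2 n ⟩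
  n * 2          ∎)
  where open ≤-Reasoning

m<n⇒n≡suc[n∸m∸1]+m : ∀ {m n} → m < n → n ≡ suc (n ∸ m ∸ 1) + m
m<n⇒n≡suc[n∸m∸1]+m {zero}  {suc n} _         = cong suc (sym (+-identityʳ n))
m<n⇒n≡suc[n∸m∸1]+m {suc m} {suc n} (s≤s m<n) = trans (cong suc (m<n⇒n≡suc[n∸m∸1]+m m<n)) (sym (+-suc _ m))

Periodic : ∀ {A : Set} → ℕ → (ℕ → A) → Set
Periodic k f = ∀ t → f (t + k) ≡ f t

module _ {A : Set} {k : ℕ} {f : ℕ → A} (periodic : Periodic k f) where

  periodic-+* : ∀ j t → f (t + j * k) ≡ f t
  periodic-+* zero    t = cong f (+-identityʳ t)
  periodic-+* (suc j) t = begin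
    f (t + (k + j * k)) ≡⟨ cong (λ r → f (t + r)) (+-comm k (j * k)) ⟩
    f (t + (j * k + k)) ≡⟨ cong f (+-assoc t (j * k) k) ⟨
    f (t + j * k + k)   ≡⟨ periodic (t + j * k) ⟩
    f (t + j * k)       ≡⟨ periodic-+* j t ⟩
    f t                 ∎
    where open ≡-Reasoning

  periodic-% : .{{_ : NonZero k}} → ∀ t → f t ≡ f (t % k)
  periodic-% t = trans (cong f (m≡m%n+[m/n]*n t k)) (periodic-+* (t / k) (t % k))

periodic-≗ : ∀ {A : Set} {k} .{{_ : NonZero k}} {f g : ℕ → A} → Periodic k f → Periodic k g →
             (∀ t → t < k → f t ≡ g t) → ∀ t → f t ≡ g t
periodic-≗ {k = k} f-periodic g-periodic agree t =
  trans (periodic-% f-periodic t) (trans (agree (t % k) (m%n<n t k)) (sym (periodic-% g-periodic t)))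

module _ {k : ℕ} .{{_ : NonZero k}} where

  [m+n%k]%k≡[m+n]%k : ∀ m n → (m + n % k) % k ≡ (m + n) % k
  [m+n%k]%k≡[m+n]%k m n = begin
    (m + n % k) % k         ≡⟨ %-distribˡ-+ m (n % k) k ⟩
    (m % k + n % k % k) % k ≡⟨ cong (λ r → (m % k + r) % k) (m%n%n≡m%n n k) ⟩
    (m % k + n % k) % k     ≡⟨ %-distribˡ-+ m n k ⟨
    (m + n) % k             ∎
    where open ≡-Reasoning

  -- adding k ∸ a % k undoes the shift by a
  +-%-cancelʳ : ∀ a {t t′} → t < k → t′ < k → (t + a) % k ≡ (t′ + a) % k → t ≡ t′
  +-%-cancelʳ a t<k t′<k eq =
    trans (unshift t<k) (trans (cong (λ r → (k ∸ a % k + r) % k) eq) (sym (unshift t′<k)))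
    where
    open ≡-Reasoning
    unshift : ∀ {u} → u < k → u ≡ (k ∸ a % k + (u + a) % k) % k
    unshift {u} u<k = begin
      u                                  ≡⟨ m<n⇒m%n≡m u<k ⟨
      u % k                              ≡⟨ [m+n]%n≡m%n u k ⟨
      (u + k) % k                        ≡⟨ cong (_% k) around ⟩
      (k ∸ a % k + (u + a % k)) % k      ≡⟨ [m+n%k]%k≡[m+n]%k (k ∸ a % k) (u + a % k) ⟨
      (k ∸ a % k + (u + a % k) % k) % k  ≡⟨ cong (λ r → (k ∸ a % k + r) % k) ([m+n%k]%k≡[m+n]%k u a) ⟩
      (k ∸ a % k + (u + a) % k) % k      ∎
      where
      around : u + k ≡ k ∸ a % k + (u + a % k)
      around = begin
        u + k                      ≡⟨ cong (u +_) (m∸n+n≡m (m%n≤n a k)) ⟨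
        u + (k ∸ a % k + a % k)    ≡⟨ cong (u +_) (+-comm (k ∸ a % k) (a % k)) ⟩
        u + (a % k + (k ∸ a % k))  ≡⟨ +-assoc u (a % k) (k ∸ a % k) ⟨
        u + a % k + (k ∸ a % k)    ≡⟨ +-comm (u + a % k) (k ∸ a % k) ⟩
        k ∸ a % k + (u + a % k)    ∎

  [m+k+n]%k≡[m+n]%k : ∀ m n → (m + k + n) % k ≡ (m + n) % k
  [m+k+n]%k≡[m+n]%k m n = trans (cong (_% k) swap) ([m+n]%n≡m%n (m + n) k)
    where
    swap : m + k + n ≡ m + n + k
    swap = trans (+-assoc m k n) (trans (cong (m +_) (+-comm k n)) (sym (+-assoc m n k)))

  mod-cong : ∀ {m n} → m % k ≡ n % k → m mod k ≡ n mod k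
  mod-cong eq = toℕ-injective (trans (toℕ-fromℕ< _) (trans eq (sym (toℕ-fromℕ< _))))

  toℕ-mod : ∀ (i : Fin k) → toℕ i mod k ≡ i
  toℕ-mod i = toℕ-injective (trans (toℕ-fromℕ< _) (m<n⇒m%n≡m (toℕ<n i)))

∣p∪q∣≤∣p∣+∣q∣ : ∀ {n} (p q : Subset n) → ∣ p ∪ q ∣ ≤ ∣ p ∣ + ∣ q ∣
∣p∪q∣≤∣p∣+∣q∣ []            []            = z≤n
∣p∪q∣≤∣p∣+∣q∣ (outside ∷ p) (outside ∷ q) = ∣p∪q∣≤∣p∣+∣q∣ p q
∣p∪q∣≤∣p∣+∣q∣ (inside  ∷ p) (outside ∷ q) = s≤s (∣p∪q∣≤∣p∣+∣q∣ p q)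
∣p∪q∣≤∣p∣+∣q∣ (outside ∷ p) (inside  ∷ q) =
  subst (suc ∣ p ∪ q ∣ ≤_) (sym (+-suc ∣ p ∣ ∣ q ∣)) (s≤s (∣p∪q∣≤∣p∣+∣q∣ p q))
∣p∪q∣≤∣p∣+∣q∣ (inside  ∷ p) (inside  ∷ q) =
  s≤s (≤-trans (∣p∪q∣≤∣p∣+∣q∣ p q) (+-monoʳ-≤ ∣ p ∣ (n≤1+n ∣ q ∣)))

fromList : ∀ {n} → List (Fin n) → Subset n
fromList []       = ∅
fromList (x ∷ xs) = ⁅ x ⁆ ∪ fromList xs

∣fromList∣≤length : ∀ {n} (xs : List (Fin n)) → ∣ fromList xs ∣ ≤ length xs
∣fromList∣≤length {n} []       = ≤-reflexive (∣⊥∣≡0 n)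
∣fromList∣≤length      (x ∷ xs) = ≤-trans (∣p∪q∣≤∣p∣+∣q∣ ⁅ x ⁆ (fromList xs))
                                          (+-mono-≤ (≤-reflexive (∣⁅x⁆∣≡1 x)) (∣fromList∣≤length xs))

∈-fromList : ∀ {n} {x : Fin n} xs → x ∈ₛ fromList xs ⇔ x ∈ xs
∈-fromList {x = x} xs = mk⇔ (to xs) from
  where
  to : ∀ xs → x ∈ₛ fromList xs → x ∈ xs
  to []       x∈ = ⊥-elim (∉⊥ x∈)
  to (y ∷ xs) x∈ with x∈p∪q⁻ ⁅ y ⁆ (fromList xs) x∈
  ... | inj₁ x∈⁅y⁆ = here (x∈⁅y⁆⇒x≡y y x∈⁅y⁆)
  ... | inj₂ x∈xs  = there (to xs x∈xs)
  from : ∀ {xs} → x ∈ xs → x ∈ₛ fromList xs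
  from (here refl) = x∈p∪q⁺ (inj₁ (x∈⁅x⁆ x))
  from (there x∈)  = x∈p∪q⁺ (inj₂ (from x∈))

∈-++-∉ʳ : ∀ {A : Set} {x : A} {xs ys} → x ∉ ys → x ∈ xs ++ ys ⇔ x ∈ xs
∈-++-∉ʳ {xs = xs} x∉ys = mk⇔ (λ x∈ → [ id , ⊥-elim ∘ x∉ys ]′ (∈-++⁻ xs x∈)) ∈-++⁺ˡ

∈-++-∉ˡ : ∀ {A : Set} {x : A} {xs ys} → x ∉ xs → x ∈ xs ++ ys ⇔ x ∈ ys
∈-++-∉ˡ {xs = xs} x∉xs = mk⇔ (λ x∈ → [ ⊥-elim ∘ x∉xs , id ]′ (∈-++⁻ xs x∈)) (∈-++⁺ʳ xs)

positions : Bool → ℕ → List ℕ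
positions c k = filterᵇ (alternate c) (downFrom k)

∈-positions : ∀ {c k t} → t ∈ positions c k ⇔ (t < k × alternate c t ≡ true)
∈-positions {c} = mk⇔
  (λ t∈ → let t∈↓ , alt = ∈-filter⁻ (T? ∘ alternate c) t∈ in ∈-downFrom⁻ t∈↓ , Equivalence.to T-≡ alt)
  (λ (t<k , alt) → ∈-filter⁺ (T? ∘ alternate c) (∈-downFrom⁺ t<k) (Equivalence.from T-≡ alt))

length-filterᵇ-opposite : ∀ {A : Set} (p : A → Bool) x y xs → p x ≡ not (p y) →
                          length (filterᵇ p (x ∷ y ∷ xs)) ≡ suc (length (filterᵇ p xs))
length-filterᵇ-opposite p x y xs eq with p x
... | true with p y
...   | false = refl
length-filterᵇ-opposite p x y xs eq | false with p y
...   | true = refl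

length-positions-*2 : ∀ c a → length (positions c (a * 2)) ≡ a
length-positions-*2 c zero    = refl
length-positions-*2 c (suc a) =
  trans (length-filterᵇ-opposite (alternate c) (suc (a * 2)) (a * 2) (downFrom (a * 2)) refl)
        (cong suc (length-positions-*2 c a))

length-positions-true-odd : ∀ a → length (positions true (suc (a * 2))) ≡ suc a
length-positions-true-odd a =
  trans (cong length (filter-accept (T? ∘ alternate true) {x = a * 2} {xs = downFrom (a * 2)}
                                    (subst T (sym (alternate-*2 true a)) _)))
        (cong suc (length-positions-*2 true a))

length-positions-false-odd : ∀ a → length (positions false (suc (a * 2))) ≡ a
length-positions-false-odd a =
  trans (cong length (filter-reject (T? ∘ alternate false) {x = a * 2} {xs = downFrom (a * 2)}
                                    (subst T (alternate-*2 false a))))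
        (length-positions-*2 false a)

module _ {m n s : ℕ} (Φ : Scheme m n s) (G : ModelGraph Φ) where
  open Scheme Φ

  answer : (Fin s → Bool) → Fin m → Bool
  answer σ u = maj (σ (x u)) (σ (y u)) (σ (z u))

  answer-endpoints : ∀ σ u → answer σ u ≡ maj (σ (end₁ Φ G u)) (σ (end₂ Φ G u)) (σ (third Φ G u))
  answer-endpoints σ u with G u
  ... | zero           = refl
  ... | suc zero       = maj-rotate (σ (x u)) (σ (y u)) (σ (z u))
  ... | suc (suc zero) = sym (maj-rotate (σ (z u)) (σ (x u)) (σ (y u)))

  answer-joins : ∀ σ {u a b} → Joins Φ G u a b → answer σ u ≡ maj (σ a) (σ b) (σ (third Φ G u))
  answer-joins σ {u} (inj₁ (refl , refl)) = answer-endpoints σ u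
  answer-joins σ {u} (inj₂ (refl , refl)) =
    trans (answer-endpoints σ u) (maj-swap (σ (end₁ Φ G u)) (σ (end₂ Φ G u)) (σ (third Φ G u)))

  assignment : (L : List (Fin m)) → length L ≤ n → ∃[ σ ] ∀ u → answer σ u ≡ true ⇔ u ∈ L
  assignment L L≤n =
    let σ , realises = valid (fromList L) (≤-trans (∣fromList∣≤length L) L≤n)
    in σ , λ u → ⇔-trans (realises u) (∈-fromList L)

  module _ {k : ℕ} (C : Cycle Φ G k) where
    open Cycle C

    instance
      length-nonZero : NonZero k
      length-nonZero = >-nonZero (≤-trans (s≤s z≤n) len≥2)

    edgeAt : ℕ → Fin m
    edgeAt t = edge (t mod k)

    vertAt : ℕ → Fin s
    vertAt t = vert (inject₁ (t mod k))

    vertAt-% : ∀ {t t′} → t % k ≡ t′ % k → vertAt t ≡ vertAt t′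
    vertAt-% = cong (vert ∘ inject₁) ∘ mod-cong

    edgeAt-% : ∀ {t t′} → t % k ≡ t′ % k → edgeAt t ≡ edgeAt t′
    edgeAt-% = cong edge ∘ mod-cong

    edgeAt-injective : ∀ {t t′} → edgeAt t ≡ edgeAt t′ → t % k ≡ t′ % k
    edgeAt-injective eq = trans (sym (toℕ-fromℕ< _)) (trans (cong toℕ (edge-inj eq)) (toℕ-fromℕ< _))

    edgeAt-toℕ : ∀ i → edgeAt (toℕ i) ≡ edge i
    edgeAt-toℕ i = cong edge (toℕ-mod i)

    vertAt-toℕ : ∀ i → vertAt (toℕ i) ≡ vert (inject₁ i)
    vertAt-toℕ i = cong (vert ∘ inject₁) (toℕ-mod i)

    vert≡vertAt : ∀ r → vert r ≡ vertAt (toℕ r)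
    vert≡vertAt r with m≤n⇒m<n∨m≡n (toℕ≤pred[n] r)
    ... | inj₁ r<k =
      cong vert (toℕ-injective (sym (trans (toℕ-inject₁ _) (trans (toℕ-fromℕ< _) (m<n⇒m%n≡m r<k)))))
    ... | inj₂ r≡k = begin
      vert r            ≡⟨ cong vert (toℕ-injective (trans r≡k (sym (toℕ-fromℕ k)))) ⟩
      vert (fromℕ k)    ≡⟨ closed ⟩
      vert zero         ≡⟨ cong vert (toℕ-injective (sym wraps)) ⟩
      vertAt (toℕ r)    ∎
      where
      open ≡-Reasoning
      wraps : toℕ (inject₁ (toℕ r mod k)) ≡ 0
      wraps = trans (toℕ-inject₁ _) (trans (toℕ-fromℕ< _) (trans (cong (_% k) r≡k) (n%n≡0 k)))

    joins-at : ∀ t → Joins Φ G (edgeAt t) (vertAt t) (vertAt (suc t))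
    joins-at t = subst (Joins Φ G (edgeAt t) (vertAt t)) next (joins (t mod k))
      where
      next : vert (suc (t mod k)) ≡ vertAt (suc t)
      next = trans (vert≡vertAt (suc (t mod k)))
                   (vertAt-% (trans (cong (λ r → suc r % k) (toℕ-fromℕ< _)) ([m+n%k]%k≡[m+n]%k {k} 1 t)))

    walkEdges : ℕ → Bool → List (Fin m)
    walkEdges a c = map (λ t → edgeAt (t + a)) (positions c k)

    length-walkEdges : ∀ a c → length (walkEdges a c) ≡ length (positions c k)
    length-walkEdges a c = length-map (λ t → edgeAt (t + a)) (positions c k)

    ∈-walkEdges : ∀ {a c t} → t < k → edgeAt (t + a) ∈ walkEdges a c ⇔ alternate c t ≡ true
    ∈-walkEdges {a} {c} {t} t<k =
      mk⇔ to (λ alt → ∈-map⁺ (λ t → edgeAt (t + a)) (Equivalence.from ∈-positions (t<k , alt)))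
      where
      to : edgeAt (t + a) ∈ walkEdges a c → alternate c t ≡ true
      to e∈ = let t′ , t′∈ , eq = ∈-map⁻ (λ t → edgeAt (t + a)) e∈
                  t′<k , alt = Equivalence.to ∈-positions t′∈
              in subst (λ r → alternate c r ≡ true) (+-%-cancelʳ a t′<k t<k (edgeAt-injective (sym eq))) alt

    Alternates : (Fin s → Bool) → ℕ → Bool → Set
    Alternates σ a c = ∀ t → t < k → answer σ (edgeAt (t + a)) ≡ alternate c t

    alternates : ∀ σ {L a c} → (∀ u → answer σ u ≡ true ⇔ u ∈ L) →
                 (∀ t → t < k → edgeAt (t + a) ∈ L ⇔ alternate c t ≡ true) → Alternates σ a c
    alternates σ realises members t t<k = ⇔→≡ (⇔-trans (realises _) (members t t<k))

    walk-joins : ∀ σ a t → maj (σ (vertAt (t + a))) (σ (vertAt (suc t + a))) (σ (third Φ G (edgeAt (t + a))))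
                           ≡ answer σ (edgeAt (t + a))
    walk-joins σ a t = sym (answer-joins σ (joins-at (t + a)))

    odd-cycle-vertex : ∀ {b} → k ≡ suc (b * 2) → ∀ σ a {c} → Alternates σ a c → σ (vertAt a) ≡ c
    odd-cycle-vertex {b} k-odd σ a {c} alt =
      odd-closed-walk (λ t → σ (vertAt (t + a))) (λ t → σ (third Φ G (edgeAt (t + a)))) c {a = b} k-odd
        (cong σ (vertAt-% ([m+k+n]%k≡[m+n]%k 0 a)))
        (λ t t<k → trans (walk-joins σ a t) (alt t t<k))

    even-cycle-thirds : ∀ {b} → k ≡ suc b * 2 → ∀ σ a {c} → Alternates σ a c →
                        ∀ t → σ (third Φ G (edgeAt (t + a))) ≡ alternate c t
    even-cycle-thirds {b} k-even σ a {c} alt =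
      even-closed-walk (λ t → σ (vertAt (t + a))) (λ t → σ (third Φ G (edgeAt (t + a)))) c {a = b} k-even
        (λ t → cong σ (vertAt-% ([m+k+n]%k≡[m+n]%k t a)))
        (λ t → trans (walk-joins σ a t) (answers t))
      where
      -- for even k the alternating labels are themselves k-periodic
      answers : ∀ t → answer σ (edgeAt (t + a)) ≡ alternate c t
      answers = periodic-≗ (λ t → cong (answer σ) (edgeAt-% ([m+k+n]%k≡[m+n]%k t a)))
                           (λ t → trans (cong (λ r → alternate c (t + r)) k-even) (alternate-+*2 c (suc b) t))
                           alt

  ∉-walkEdges : ∀ {k l} (C : Cycle Φ G k) (D : Cycle Φ G l) →
                (∀ r r′ → Cycle.edge C r ≢ Cycle.edge D r′) → ∀ {b d} t → edgeAt C t ∉ walkEdges D b d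
  ∉-walkEdges C D disjoint {b} t e∈ =
    let _ , _ , eq = ∈-map⁻ (λ t′ → edgeAt D (t′ + b)) e∈ in disjoint _ _ eq

  two-cycle-assignment : ∀ {k l} (C : Cycle Φ G k) (D : Cycle Φ G l) → EdgeDisjoint Φ G C D →
                         ∀ a b c d → length (positions c k) + length (positions d l) ≤ n →
                         ∃[ σ ] Alternates C σ a c × Alternates D σ b d
  two-cycle-assignment {k} {l} C D disjoint a b c d fits =
    let σ , realises = assignment (walkEdges C a c ++ walkEdges D b d) (≤-trans (≤-reflexive size) fits)
    in σ , alternates C σ realises onC , alternates D σ realises onD
    where
    size : length (walkEdges C a c ++ walkEdges D b d) ≡ length (positions c k) + length (positions d l)
    size = trans (length-++ (walkEdges C a c))
                 (cong₂ _+_ (length-walkEdges C a c) (length-walkEdges D b d))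
    onC : ∀ t → t < k → edgeAt C (t + a) ∈ walkEdges C a c ++ walkEdges D b d ⇔ alternate c t ≡ true
    onC t t<k = ⇔-trans (∈-++-∉ʳ (∉-walkEdges C D disjoint (t + a))) (∈-walkEdges C t<k)
    onD : ∀ t → t < l → edgeAt D (t + b) ∈ walkEdges C a c ++ walkEdges D b d ⇔ alternate d t ≡ true
    onD t t<l =
      ⇔-trans (∈-++-∉ˡ (∉-walkEdges D C (λ r r′ → disjoint r′ r ∘ sym) (t + b))) (∈-walkEdges D t<l)

  one-cycle-assignment : ∀ {k} (C : Cycle Φ G k) a c → length (positions c k) ≤ n →
                         ∃[ σ ] Alternates C σ a c
  one-cycle-assignment C a c fits =
    let σ , realises = assignment (walkEdges C a c) (≤-trans (≤-reflexive (length-walkEdges C a c)) fits)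
    in σ , alternates C σ realises (λ t t<k → ∈-walkEdges C t<k)

  odd-cycles-vertex-disjoint : ∀ {a b} (C : Cycle Φ G (suc (a * 2))) (D : Cycle Φ G (suc (b * 2))) →
                               EdgeDisjoint Φ G C D → suc a + b ≤ n →
                               ∀ i j → Cycle.vert C (inject₁ i) ≢ Cycle.vert D (inject₁ j)
  odd-cycles-vertex-disjoint {a} {b} C D disjoint fits i j shared =
    let σ , onC , onD = two-cycle-assignment C D disjoint (toℕ i) (toℕ j) true false fits′
    in not-¬ refl (begin
      true                       ≡⟨ odd-cycle-vertex C {a} refl σ (toℕ i) onC ⟨
      σ (vertAt C (toℕ i))       ≡⟨ cong σ (trans (vertAt-toℕ C i) shared) ⟩
      σ (Cycle.vert D (inject₁ j)) ≡⟨ cong σ (vertAt-toℕ D j) ⟨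
      σ (vertAt D (toℕ j))       ≡⟨ odd-cycle-vertex D {b} refl σ (toℕ j) onD ⟩
      false                      ∎)
    where
    open ≡-Reasoning
    fits′ = subst (_≤ n) (sym (cong₂ _+_ (length-positions-true-odd a) (length-positions-false-odd b))) fits

  even-cycles-never-meet : ∀ {a b} (C : Cycle Φ G (suc a * 2)) (D : Cycle Φ G (suc b * 2)) →
                           EdgeDisjoint Φ G C D → suc a + suc b ≤ n →
                           ∀ i j → third Φ G (Cycle.edge C i) ≢ third Φ G (Cycle.edge D j)
  even-cycles-never-meet {a} {b} C D disjoint fits i j meet =
    let σ , onC , onD = two-cycle-assignment C D disjoint (toℕ i) (toℕ j) true false fits′
    in not-¬ refl (begin
      true                                ≡⟨ even-cycle-thirds C {a} refl σ (toℕ i) onC 0 ⟨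
      σ (third Φ G (edgeAt C (toℕ i)))    ≡⟨ cong σ (trans (cong (third Φ G) (edgeAt-toℕ C i)) meet) ⟩
      σ (third Φ G (Cycle.edge D j))      ≡⟨ cong (σ ∘ third Φ G) (edgeAt-toℕ D j) ⟨
      σ (third Φ G (edgeAt D (toℕ j)))    ≡⟨ even-cycle-thirds D {b} refl σ (toℕ j) onD 0 ⟩
      false                               ∎)
    where
    open ≡-Reasoning
    fits′ = subst (_≤ n) (sym (cong₂ _+_ (length-positions-*2 true (suc a)) (length-positions-*2 false (suc b))))
                  fits

  even-cycle-thirds-differ : ∀ {a} (C : Cycle Φ G (suc a * 2)) → suc a ≤ n →
                         ∀ i j q → toℕ j ≡ suc (q * 2) + toℕ i →
                         third Φ G (Cycle.edge C i) ≢ third Φ G (Cycle.edge C j)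
  even-cycle-thirds-differ {a} C fits i j q j≡ same =
    let σ , onC = one-cycle-assignment C (toℕ i) true fits′
    in not-¬ refl (begin
      true                                            ≡⟨ even-cycle-thirds C {a} refl σ (toℕ i) onC 0 ⟨
      σ (third Φ G (edgeAt C (toℕ i)))                ≡⟨ cong σ (trans (cong (third Φ G) (edgeAt-toℕ C i)) same) ⟩
      σ (third Φ G (Cycle.edge C j))                  ≡⟨ cong (σ ∘ third Φ G) edge-j ⟨
      σ (third Φ G (edgeAt C (suc (q * 2) + toℕ i))) ≡⟨ even-cycle-thirds C {a} refl σ (toℕ i) onC (suc (q * 2)) ⟩
      not (alternate true (q * 2))                    ≡⟨ cong not (alternate-*2 true q) ⟩
      false                                           ∎)
    where
    open ≡-Reasoning
    fits′ = subst (_≤ n) (sym (length-positions-*2 true (suc a))) fits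
    edge-j : edgeAt C (suc (q * 2) + toℕ i) ≡ Cycle.edge C j
    edge-j = trans (cong (edgeAt C) (sym j≡)) (edgeAt-toℕ C j)

  ¬P1 : ¬ P1 Φ G
  ¬P1 (k , l , C , D , k-odd , l-odd , k≤n , l≤n , disjoint , i , j , shared)
    with odd⇒≡suc[*2] k-odd | odd⇒≡suc[*2] l-odd
  ... | a , refl | b , refl = odd-cycles-vertex-disjoint {a} {b} C D disjoint fits i j shared
    where
    fits : suc a + b ≤ n
    fits = halve-≤ (suc a) b (subst (_≤ n + n) (cong suc (+-suc (a * 2) (b * 2))) (+-mono-≤ k≤n l≤n))

  ¬P2 : ¬ P2 Φ G
  ¬P2 (k , l , C , D , k-even , l-even , k≤n , l≤n , disjoint , i , j , meet)
    with even⇒≡suc*2 (Cycle.len≥2 C) k-even | even⇒≡suc*2 (Cycle.len≥2 D) l-even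
  ... | a , refl | b , refl =
    even-cycles-never-meet {a} {b} C D disjoint (halve-≤ (suc a) (suc b) (+-mono-≤ k≤n l≤n)) i j meet

  ¬P3 : ¬ P3 Φ G
  ¬P3 (k , C , k-even , k≤n , i , j , i<j , divides q gap≡q*2 , same)
    with even⇒≡suc*2 (Cycle.len≥2 C) k-even
  ... | a , refl =
    even-cycle-thirds-differ {a} C (≤-trans (m≤m*n (suc a) 2) k≤n) i j q
      (trans (m<n⇒n≡suc[n∸m∸1]+m i<j) (cong (λ r → suc r + toℕ i) gap≡q*2)) same

lemma5 : ∀ {m n s : ℕ} (Φ : Scheme m n s) (G : ModelGraph Φ) → ¬ Forced Φ G
lemma5 Φ G = [ ¬P1 Φ G , [ ¬P2 Φ G , ¬P3 Φ G ]′ ]′
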